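{- Let $k\geq 1$ be an integer and let $L$ be a $4k$-list-assignment of a graph $G$ such that for each vertex $v$ of $G$ and each colour $c\in L(v)$, there are at most $k$ neighbours $w\in N_G(v)$ with $c\in L(w)$. Then there exist at least $(2k)^{|V(G)|}$ proper $L$-colourings of $G$.
   Context: Graphs are finite and simple; $N_G(v)$ is the set of neighbours of $v$. A $4k$-list-assignment $L$ assigns each vertex $v$ a set $L(v)$ of exactly $4k$ colours. An $L$-colouring is a function $\phi$ with $\phi(v)\in L(v)$ for all $v$; it is proper if adjacent vertices receive different colours. -}

module Defs where

open import Data.Nat using (ℕ; _*_; _≤_)
open import Data.Nat.Properties using (_≟_)
open import Data.Fin using (Fin)
open import Data.Bool using (Bool; true)
open import Data.Bool.Properties using () renaming (_≟_ to _≟ᵇ_)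
open import Data.Empty using (⊥)
open import Data.List using (List; length; filter; allFin)
open import Data.List.Relation.Unary.Unique.Propositional using (Unique)
open import Data.List.Relation.Unary.AllPairs using (AllPairs)
open import Data.List.Relation.Unary.All using (All)
open import Data.List.Membership.DecPropositional _≟_ using (_∈_; _∈?_)
open import Data.Product using (_×_)
open import Relation.Nullary using (¬_)
open import Relation.Nullary.Decidable using (_×-dec_)
open import Relation.Binary.PropositionalEquality using (_≡_; _≢_)

record Graph (n : ℕ) : Set where
  field
    adj        : Fin n → Fin n → Bool
    adj-sym    : ∀ u v → adj u v ≡ adj v u
    adj-irrefl : ∀ v → adj v v ≢ true
open Graph public

ListAssignment : ℕ → Set
ListAssignment n = Fin n → List ℕ

IsSizeListAssignment : {n : ℕ} → ℕ → ListAssignment n → Set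
IsSizeListAssignment m L = ∀ v → Unique (L v) × length (L v) ≡ m

nbrsWithColour : {n : ℕ} → Graph n → ListAssignment n → Fin n → ℕ → ℕ
nbrsWithColour G L v c =
  length (filter (λ w → (adj G v w ≟ᵇ true) ×-dec (c ∈? L w)) (allFin _))

IsProperLColouring : {n : ℕ} → Graph n → ListAssignment n → (Fin n → ℕ) → Set
IsProperLColouring G L φ =
  (∀ v → φ v ∈ L v) × (∀ u v → adj G u v ≡ true → φ u ≢ φ v)

Distinct : {n : ℕ} → (Fin n → ℕ) → (Fin n → ℕ) → Set
Distinct φ ψ = ¬ (∀ v → φ v ≡ ψ v)

AtLeastProperLColourings : {n : ℕ} → Graph n → ListAssignment n → ℕ → Set
AtLeastProperLColourings {n} G L N =
  Data.Product.Σ (List (Fin n → ℕ)) λ cs →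
    All (IsProperLColouring G L) cs × AllPairs Distinct cs × N ≤ length cs

-- For S ⊆ V(G) let P(S) be the number of proper L-colourings of G[S], where every list has
-- m colours and every colour of L(v) lies in the lists of at most k neighbours of v.  If
-- r² + mk ≤ mr then r·P(S − w) ≤ P(S) for all w ∈ S, by induction on |S|: each of the
-- m·P(S − w) pairs (colouring of G[S − w], colour a ∈ L(w)) extends to a colouring of G[S]
-- unless some neighbour u ∈ S − w of w already has colour a.  For fixed a and u there are at
-- most P(S − w − u) ≤ P(S − w)/r such colourings, and at most k neighbours u have a in their
-- lists, so m·P(S − w) ≤ P(S) + mk·P(S − w)/r.  Removing the vertices one at a time gives
-- P(V(G)) ≥ r^n; the theorem is the case m = 4k, r = 2k.
module Submission where

open import Defs
open import Data.Bool using (true; false; if_then_else_)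
open import Data.Bool.Properties using () renaming (_≟_ to _≟ᵇ_)
open import Data.Fin using (Fin; zero; suc; cast)
open import Data.Fin.Properties using (_≟_; cast-involutive; all?; any?)
open import Data.Fin.Subset
  using (Subset; inside; outside; ⊤; ⁅_⁆; _─_; _-_; ∣_∣; Nonempty)
  renaming (_∈_ to _∈ₛ_; _∉_ to _∉ₛ_)
open import Data.Fin.Subset.Properties
  using (p─⊥≡p; x∈⁅x⁆; p─q⊆p; x∈p∧x≢y⇒x∈p-y; x∈p⇒∣p-x∣<∣p∣; nonempty?; Empty-unique; ∣⊥∣≡0; ∈⊤; ∣⊤∣≡n)
  renaming (_∈?_ to _∈ₛ?_)
open import Data.List as List
  using (List; []; _∷_; _++_; map; length; filter; tabulate; allFin; cartesianProductWith)
open import Data.List.Membership.Propositional using (_∈_)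
open import Data.List.Membership.Propositional.Properties using (∈-lookup)
open import Data.List.Properties using (filter-++; length-++; length-map)
open import Data.List.Relation.Unary.All as All using ([])
import Data.List.Relation.Unary.All.Properties as All
open import Data.List.Relation.Unary.AllPairs as AllPairs using ([]; _∷_)
import Data.List.Relation.Unary.AllPairs.Properties as AllPairs
open import Data.List.Relation.Unary.Any using (index)
open import Data.List.Relation.Unary.Any.Properties using (lookup-index)
open import Data.List.Relation.Unary.Unique.Propositional using (Unique)
open import Data.List.Relation.Unary.Unique.Propositional.Properties
  using (cartesianProductWith⁺; allFin⁺; filter⁺)
open import Data.Nat using (ℕ; zero; suc; _+_; _*_; _^_; _≤_; _<_; _≥_; z≤n; NonZero)
open import Data.Nat.Induction using (<-wellFounded)
open import Data.Nat.Properties hiding (_≟_)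
open import Algebra.Properties.Semiring.Sum +-*-semiring
  using (sum; sum-syntax; sum-cong-≗; sum-replicate-zero; ∑-comm; ∑-distrib-+; *-distribˡ-sum; *-distribʳ-sum)
import Data.Nat.Properties as ℕ
open import Data.List.Membership.DecPropositional ℕ._≟_ using (_∈?_)
open import Data.Nat.Tactic.RingSolver using (solve-∀)
open import Data.Product using (_×_; _,_; proj₁; proj₂; ∃-syntax)
open import Data.Vec as Vec using (Vec; []; _∷_; lookup; _[_]≔_; replicate; here; there)
open import Data.Vec.Properties
  using (∷-injective; lookup∘update; lookup∘update′; lookup-replicate; tabulate∘lookup; tabulate-cong)
open import Function using (_∘_; _on_)
open import Induction.WellFounded as WF using (WellFounded)
open import Relation.Binary.Construct.On using () renaming (wellFounded to on-wellFounded)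
open import Relation.Binary.PropositionalEquality
open import Relation.Nullary using (Dec; yes; no; does; ¬_; contradiction)
open import Relation.Nullary.Decidable using (_×-dec_; _→-dec_; ¬?)

𝟙 : ∀ {p} {P : Set p} → Dec P → ℕ
𝟙 d = if does d then 1 else 0

𝟙-yes : ∀ {p} {P : Set p} (d : Dec P) → P → 𝟙 d ≡ 1
𝟙-yes (yes _) _ = refl
𝟙-yes (no ¬p) p = contradiction p ¬p

𝟙-no : ∀ {p} {P : Set p} (d : Dec P) → ¬ P → 𝟙 d ≡ 0
𝟙-no (yes p) ¬p = contradiction p ¬p
𝟙-no (no _)  _  = refl

𝟙-≤ : ∀ {p} {P : Set p} (d : Dec P) {R} → (P → 1 ≤ R) → 𝟙 d ≤ R
𝟙-≤ (yes p) 1≤R = 1≤R p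
𝟙-≤ (no _)  _   = z≤n

𝟙-mono : ∀ {p q} {P : Set p} {Q : Set q} (d : Dec P) (e : Dec Q) → (P → Q) → 𝟙 d ≤ 𝟙 e
𝟙-mono (no _)  _ _   = z≤n
𝟙-mono (yes p) e p⇒q = ≤-reflexive (sym (𝟙-yes e (p⇒q p)))

𝟙-mono₂ : ∀ {p q r} {P : Set p} {Q : Set q} {R : Set r} (d : Dec P) (e : Dec Q) (f : Dec R) →
          (P → Q → R) → 𝟙 d * 𝟙 e ≤ 𝟙 f
𝟙-mono₂ (yes p) (yes q) f h = ≤-reflexive (sym (𝟙-yes f (h p q)))
𝟙-mono₂ (yes _) (no _)  f h = z≤n
𝟙-mono₂ (no _)  e       f h = z≤n

sum-mono-≤ : ∀ {n} {f g : Fin n → ℕ} → (∀ i → f i ≤ g i) → sum f ≤ sum g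
sum-mono-≤ {zero}  f≤g = z≤n
sum-mono-≤ {suc n} f≤g = +-mono-≤ (f≤g zero) (sum-mono-≤ (f≤g ∘ suc))

sum-const : ∀ n c → ∑[ i < n ] c ≡ n * c
sum-const zero    c = refl
sum-const (suc n) c = cong (c +_) (sum-const n c)

≤-sum : ∀ {n} (f : Fin n → ℕ) i → f i ≤ sum f
≤-sum f zero    = m≤m+n _ _
≤-sum f (suc i) = ≤-trans (≤-sum (f ∘ suc) i) (m≤n+m _ _)

∑-pickˡ : ∀ {n} (a : Fin n) (f : Fin n → ℕ) → ∑[ c < n ] (𝟙 (c ≟ a) * f c) ≡ f a
∑-pickˡ {suc n} zero    f = trans (cong₂ _+_ (+-identityʳ (f zero)) (sum-replicate-zero n)) (+-identityʳ (f zero))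
∑-pickˡ {suc n} (suc a) f = ∑-pickˡ a (f ∘ suc)

∑-pickʳ : ∀ {n} (a : Fin n) (f : Fin n → ℕ) → ∑[ c < n ] (𝟙 (a ≟ c) * f c) ≡ f a
∑-pickʳ {suc n} zero    f = trans (cong₂ _+_ (+-identityʳ (f zero)) (sum-replicate-zero n)) (+-identityʳ (f zero))
∑-pickʳ {suc n} (suc a) f = ∑-pickʳ a (f ∘ suc)

r*A≤P : ∀ {r m k A P B} .{{_ : NonZero r}} → r * r + m * k ≤ m * r →
        m * A ≤ P + B → r * B ≤ m * (k * A) → r * A ≤ P
r*A≤P {r} {m} {k} {A} {P} {B} r²+mk≤mr mA≤P+B rB≤mkA =
  *-cancelˡ-≤ r (+-cancelʳ-≤ (m * (k * A)) (r * (r * A)) (r * P) (begin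
    r * (r * A) + m * (k * A) ≡⟨ regroupˡ r m k A ⟩
    (r * r + m * k) * A       ≤⟨ *-monoˡ-≤ A r²+mk≤mr ⟩
    m * r * A                 ≡⟨ regroupʳ r m A ⟩
    r * (m * A)               ≤⟨ *-monoʳ-≤ r mA≤P+B ⟩
    r * (P + B)               ≡⟨ *-distribˡ-+ r P B ⟩
    r * P + r * B             ≤⟨ +-monoʳ-≤ (r * P) rB≤mkA ⟩
    r * P + m * (k * A)       ∎))
  where
  open ≤-Reasoning
  regroupˡ : ∀ r m k A → r * (r * A) + m * (k * A) ≡ (r * r + m * k) * A
  regroupˡ = solve-∀
  regroupʳ : ∀ r m A → m * r * A ≡ r * (m * A)
  regroupʳ = solve-∀

Unique⇒lookup-injective : ∀ {a} {A : Set a} {xs : List A} → Unique xs →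
                          ∀ {i j} → List.lookup xs i ≡ List.lookup xs j → i ≡ j
Unique⇒lookup-injective (_  ∷ _)   {zero}  {zero}  _  = refl
Unique⇒lookup-injective (x∉ ∷ _)   {zero}  {suc j} eq = contradiction eq (All.lookup x∉ (∈-lookup j))
Unique⇒lookup-injective (x∉ ∷ _)   {suc i} {zero}  eq = contradiction (sym eq) (All.lookup x∉ (∈-lookup i))
Unique⇒lookup-injective (_  ∷ xs!) {suc i} {suc j} eq = cong suc (Unique⇒lookup-injective xs! eq)

length-filter-tabulate : ∀ {a p} {A : Set a} {P : A → Set p} (P? : ∀ x → Dec (P x)) {n} (f : Fin n → A) →
                         length (filter P? (tabulate f)) ≡ ∑[ i < n ] 𝟙 (P? (f i))
length-filter-tabulate P? {zero}  f = refl
length-filter-tabulate P? {suc n} f with does (P? (f zero))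
... | true  = cong suc (length-filter-tabulate P? (f ∘ suc))
... | false = length-filter-tabulate P? (f ∘ suc)

module _ {a b p} {A : Set a} {B : Set b} {P : B → Set p} (P? : ∀ x → Dec (P x)) where

  length-filter-map : (f : A → B) (xs : List A) → length (filter P? (map f xs)) ≡ length (filter (P? ∘ f) xs)
  length-filter-map f []       = refl
  length-filter-map f (x ∷ xs) with does (P? (f x))
  ... | true  = cong suc (length-filter-map f xs)
  ... | false = length-filter-map f xs

  length-filter-cartesianProductWith : ∀ {c} {C : Set c} (f : C → A → B) {j} (g : Fin j → C) (ys : List A) →
    length (filter P? (cartesianProductWith f (tabulate g) ys)) ≡ ∑[ i < j ] length (filter (P? ∘ f (g i)) ys)
  length-filter-cartesianProductWith f {zero}  g ys = refl
  length-filter-cartesianProductWith f {suc j} g ys = begin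
    length (filter P? (map (f (g zero)) ys ++ rest))
      ≡⟨ cong length (filter-++ P? (map (f (g zero)) ys) rest) ⟩
    length (filter P? (map (f (g zero)) ys) ++ filter P? rest)
      ≡⟨ length-++ (filter P? (map (f (g zero)) ys)) ⟩
    length (filter P? (map (f (g zero)) ys)) + length (filter P? rest)
      ≡⟨ cong₂ _+_ (length-filter-map (f (g zero)) ys) (length-filter-cartesianProductWith f (g ∘ suc) ys) ⟩
    length (filter (P? ∘ f (g zero)) ys) + ∑[ i < j ] length (filter (P? ∘ f (g (suc i))) ys) ∎
    where
    open ≡-Reasoning
    rest = cartesianProductWith f (tabulate (g ∘ suc)) ys

module _ {m : ℕ} where

  ∑ᵛ : ∀ n → (Vec (Fin m) n → ℕ) → ℕ
  ∑ᵛ zero    f = f []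
  ∑ᵛ (suc n) f = ∑[ a < m ] ∑ᵛ n (f ∘ (a ∷_))

  ∑ᵛ-cong : ∀ n {f g : Vec (Fin m) n → ℕ} → (∀ x → f x ≡ g x) → ∑ᵛ n f ≡ ∑ᵛ n g
  ∑ᵛ-cong zero    f≗g = f≗g []
  ∑ᵛ-cong (suc n) f≗g = sum-cong-≗ (λ a → ∑ᵛ-cong n (f≗g ∘ (a ∷_)))

  ∑ᵛ-mono-≤ : ∀ n {f g : Vec (Fin m) n → ℕ} → (∀ x → f x ≤ g x) → ∑ᵛ n f ≤ ∑ᵛ n g
  ∑ᵛ-mono-≤ zero    f≤g = f≤g []
  ∑ᵛ-mono-≤ (suc n) f≤g = sum-mono-≤ (λ a → ∑ᵛ-mono-≤ n (f≤g ∘ (a ∷_)))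

  ∑ᵛ-zero : ∀ n → ∑ᵛ n (λ _ → 0) ≡ 0
  ∑ᵛ-zero zero    = refl
  ∑ᵛ-zero (suc n) = trans (sum-cong-≗ {m} (λ _ → ∑ᵛ-zero n)) (sum-replicate-zero m)

  ≤-∑ᵛ : ∀ n (f : Vec (Fin m) n → ℕ) x → f x ≤ ∑ᵛ n f
  ≤-∑ᵛ zero    f []      = ≤-refl
  ≤-∑ᵛ (suc n) f (a ∷ x) = ≤-trans (≤-∑ᵛ n (f ∘ (a ∷_)) x) (≤-sum (λ b → ∑ᵛ n (f ∘ (b ∷_))) a)

  *-distribˡ-∑ᵛ : ∀ n c (f : Vec (Fin m) n → ℕ) → c * ∑ᵛ n f ≡ ∑ᵛ n (λ x → c * f x)
  *-distribˡ-∑ᵛ zero    c f = refl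
  *-distribˡ-∑ᵛ (suc n) c f =
    trans (*-distribˡ-sum c (λ a → ∑ᵛ n (f ∘ (a ∷_))))
          (sum-cong-≗ (λ a → *-distribˡ-∑ᵛ n c (f ∘ (a ∷_))))

  ∑ᵛ-distrib-+ : ∀ n (f g : Vec (Fin m) n → ℕ) → ∑ᵛ n (λ x → f x + g x) ≡ ∑ᵛ n f + ∑ᵛ n g
  ∑ᵛ-distrib-+ zero    f g = refl
  ∑ᵛ-distrib-+ (suc n) f g =
    trans (sum-cong-≗ (λ a → ∑ᵛ-distrib-+ n (f ∘ (a ∷_)) (g ∘ (a ∷_))))
          (∑-distrib-+ (λ a → ∑ᵛ n (f ∘ (a ∷_))) (λ a → ∑ᵛ n (g ∘ (a ∷_))))

  ∑ᵛ-∑-comm : ∀ n {j} (h : Fin j → Vec (Fin m) n → ℕ) →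
              ∑ᵛ n (λ x → ∑[ i < j ] h i x) ≡ ∑[ i < j ] ∑ᵛ n (h i)
  ∑ᵛ-∑-comm zero    h = refl
  ∑ᵛ-∑-comm (suc n) h =
    trans (sum-cong-≗ (λ a → ∑ᵛ-∑-comm n (λ i → h i ∘ (a ∷_))))
          (∑-comm (λ a i → ∑ᵛ n (h i ∘ (a ∷_))))

  ∑ᵛ-update : ∀ n (w : Fin n) (a b : Fin m) (f : Vec (Fin m) n → ℕ) →
              ∑ᵛ n (λ x → 𝟙 (lookup x w ≟ a) * f x) ≡ ∑ᵛ n (λ x → 𝟙 (lookup x w ≟ b) * f (x [ w ]≔ a))
  ∑ᵛ-update (suc n) (suc w) a b f = sum-cong-≗ (λ c → ∑ᵛ-update n w a b (f ∘ (c ∷_)))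
  ∑ᵛ-update (suc n) zero    a b f = begin
    ∑[ c < m ] ∑ᵛ n (λ x → 𝟙 (c ≟ a) * f (c ∷ x))
      ≡⟨ sum-cong-≗ (λ c → *-distribˡ-∑ᵛ n (𝟙 (c ≟ a)) (f ∘ (c ∷_))) ⟨
    ∑[ c < m ] (𝟙 (c ≟ a) * ∑ᵛ n (f ∘ (c ∷_)))
      ≡⟨ ∑-pickˡ a (λ c → ∑ᵛ n (f ∘ (c ∷_))) ⟩
    ∑ᵛ n (f ∘ (a ∷_))
      ≡⟨ ∑-pickˡ b (λ _ → ∑ᵛ n (f ∘ (a ∷_))) ⟨
    ∑[ c < m ] (𝟙 (c ≟ b) * ∑ᵛ n (f ∘ (a ∷_)))
      ≡⟨ sum-cong-≗ (λ c → *-distribˡ-∑ᵛ n (𝟙 (c ≟ b)) (f ∘ (a ∷_))) ⟩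
    ∑[ c < m ] ∑ᵛ n (λ x → 𝟙 (c ≟ b) * f (a ∷ x)) ∎
    where open ≡-Reasoning

  ∑ᵛ-fibrewise : ∀ n (w : Fin n) (b : Fin m) (f : Vec (Fin m) n → ℕ) →
                 ∑[ a < m ] ∑ᵛ n (λ x → 𝟙 (lookup x w ≟ b) * f (x [ w ]≔ a)) ≡ ∑ᵛ n f
  ∑ᵛ-fibrewise n w b f = begin
    ∑[ a < m ] ∑ᵛ n (λ x → 𝟙 (lookup x w ≟ b) * f (x [ w ]≔ a))
      ≡⟨ sum-cong-≗ (λ a → ∑ᵛ-update n w a b f) ⟨
    ∑[ a < m ] ∑ᵛ n (λ x → 𝟙 (lookup x w ≟ a) * f x)
      ≡⟨ ∑ᵛ-∑-comm n (λ a x → 𝟙 (lookup x w ≟ a) * f x) ⟨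
    ∑ᵛ n (λ x → ∑[ a < m ] (𝟙 (lookup x w ≟ a) * f x))
      ≡⟨ ∑ᵛ-cong n (λ x → ∑-pickʳ (lookup x w) (λ _ → f x)) ⟩
    ∑ᵛ n f ∎
    where open ≡-Reasoning

  allVecs : ∀ n → List (Vec (Fin m) n)
  allVecs zero    = [] ∷ []
  allVecs (suc n) = cartesianProductWith _∷_ (allFin m) (allVecs n)

  allVecs-unique : ∀ n → Unique (allVecs n)
  allVecs-unique zero    = [] ∷ []
  allVecs-unique (suc n) = cartesianProductWith⁺ _∷_ ∷-injective (allFin⁺ m) (allVecs-unique n)

  length-filter-allVecs : ∀ n {p} {P : Vec (Fin m) n → Set p} (P? : ∀ x → Dec (P x)) →
                          length (filter P? (allVecs n)) ≡ ∑ᵛ n (𝟙 ∘ P?)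
  length-filter-allVecs zero    P? with does (P? [])
  ... | true  = refl
  ... | false = refl
  length-filter-allVecs (suc n) P? =
    trans (length-filter-cartesianProductWith P? _∷_ (λ a → a) (allVecs n))
          (sum-cong-≗ (λ a → length-filter-allVecs n (P? ∘ (a ∷_))))

x∈p─q⇒x∉q : ∀ {n} {p q : Subset n} {x} → x ∈ₛ p ─ q → x ∉ₛ q
x∈p─q⇒x∉q {p = _ ∷ _} {q = outside ∷ _} here       ()
x∈p─q⇒x∉q {p = _ ∷ _} {q = _ ∷ _}       (there x∈) (there x∈q) = x∈p─q⇒x∉q x∈ x∈q

x∉p-x : ∀ {n} {p : Subset n} x → x ∉ₛ p - x
x∉p-x x x∈p-x = x∈p─q⇒x∉q x∈p-x (x∈⁅x⁆ x)

x∈p-y⁻ : ∀ {n} {p : Subset n} {x y} → x ∈ₛ p - y → x ∈ₛ p × x ≢ y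
x∈p-y⁻ {p = p} {y = y} x∈ = p─q⊆p p ⁅ y ⁆ x∈ , λ { refl → x∉p-x y x∈ }

x∈p⇒suc∣p-x∣≡∣p∣ : ∀ {n} {p : Subset n} {x} → x ∈ₛ p → suc ∣ p - x ∣ ≡ ∣ p ∣
x∈p⇒suc∣p-x∣≡∣p∣ {p = _ ∷ p}       here       = cong (suc ∘ ∣_∣) (p─⊥≡p p)
x∈p⇒suc∣p-x∣≡∣p∣ {p = inside ∷ _}  (there x∈) = cong suc (x∈p⇒suc∣p-x∣≡∣p∣ x∈)
x∈p⇒suc∣p-x∣≡∣p∣ {p = outside ∷ _} (there x∈) = x∈p⇒suc∣p-x∣≡∣p∣ x∈

size-wellFounded : ∀ {n} → WellFounded (_<_ on ∣_∣ {n})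
size-wellFounded = on-wellFounded ∣_∣ <-wellFounded

zero′ : ∀ {m} .{{_ : NonZero m}} → Fin m
zero′ {suc m} = zero

module ListColouring {n} (G : Graph n) (L : ListAssignment n) {m} .{{_ : NonZero m}}
                     (L-size : IsSizeListAssignment m L) where

  colour : Fin n → Fin m → ℕ
  colour v i = List.lookup (L v) (cast (sym (proj₂ (L-size v))) i)

  colour-∈ : ∀ v i → colour v i ∈ L v
  colour-∈ v i = ∈-lookup _

  colour-injective : ∀ v {i j} → colour v i ≡ colour v j → i ≡ j
  colour-injective v {i} {j} eq = begin
    i                   ≡⟨ cast-involutive |L| (sym |L|) i ⟨
    cast |L| (cast _ i) ≡⟨ cong (cast |L|) (Unique⇒lookup-injective (proj₁ (L-size v)) eq) ⟩
    cast |L| (cast _ j) ≡⟨ cast-involutive |L| (sym |L|) j ⟩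
    j                   ∎
    where open ≡-Reasoning
          |L| = proj₂ (L-size v)

  colour-surjective : ∀ v {c} → c ∈ L v → ∃[ i ] colour v i ≡ c
  colour-surjective v c∈ =
    cast |L| (index c∈) ,
    trans (cong (List.lookup (L v)) (cast-involutive (sym |L|) |L| (index c∈))) (sym (lookup-index c∈))
    where |L| = proj₂ (L-size v)

  -- A colouring of G[S] is
  -- encoded by giving every vertex outside S the index zero′, so that count S is the number
  -- of proper L-colourings of G[S].
  Colouring : Set
  Colouring = Vec (Fin m) n

  toColouring : Colouring → Fin n → ℕ
  toColouring x v = colour v (lookup x v)

  toColouring∘update′ : ∀ x {u v} b → v ≢ u → toColouring (x [ u ]≔ b) v ≡ toColouring x v
  toColouring∘update′ x {v = v} b v≢u = cong (colour v) (lookup∘update′ v≢u x b)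

  toColouring-injective : ∀ {x y} → (∀ v → toColouring x v ≡ toColouring y v) → x ≡ y
  toColouring-injective {x} {y} same = begin
    x                       ≡⟨ tabulate∘lookup x ⟨
    Vec.tabulate (lookup x) ≡⟨ tabulate-cong (λ v → colour-injective v (same v)) ⟩
    Vec.tabulate (lookup y) ≡⟨ tabulate∘lookup y ⟩
    y                       ∎
    where open ≡-Reasoning

  ZeroOff : Subset n → Colouring → Set
  ZeroOff S x = ∀ v → v ∉ₛ S → lookup x v ≡ zero′

  ProperOn : Subset n → Colouring → Set
  ProperOn S x = ∀ u v → u ∈ₛ S → v ∈ₛ S → adj G u v ≡ true → toColouring x u ≢ toColouring x v

  IsColouringOf : Subset n → Colouring → Set
  IsColouringOf S x = ZeroOff S x × ProperOn S x

  isColouringOf? : ∀ S x → Dec (IsColouringOf S x)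
  isColouringOf? S x =
    all? (λ v → ¬? (v ∈ₛ? S) →-dec (lookup x v ≟ zero′)) ×-dec
    all? (λ u → all? (λ v → (u ∈ₛ? S) →-dec ((v ∈ₛ? S) →-dec ((adj G u v ≟ᵇ true) →-dec
      ¬? (toColouring x u ℕ.≟ toColouring x v)))))

  χ : Subset n → Colouring → ℕ
  χ S x = 𝟙 (isColouringOf? S x)

  count : Subset n → ℕ
  count S = ∑ᵛ n (χ S)

  toColouring-proper : ∀ {x} → IsColouringOf ⊤ x → IsProperLColouring G L (toColouring x)
  toColouring-proper (_ , proper) = (λ v → colour-∈ v _) , (λ u v u~v → proper u v ∈⊤ ∈⊤ u~v)

  restrict : ∀ {S u x} b → u ∈ₛ S → lookup x u ≡ zero′ → IsColouringOf S (x [ u ]≔ b) →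
             IsColouringOf (S - u) x
  restrict {S} {u} {x} b u∈S xu≡0 (zero-off , proper) = zero-off′ , proper′
    where
    zero-off′ : ZeroOff (S - u) x
    zero-off′ v v∉S-u with v ≟ u
    ... | yes refl = xu≡0
    ... | no  v≢u  = trans (sym (lookup∘update′ v≢u x b))
                           (zero-off v (λ v∈S → v∉S-u (x∈p∧x≢y⇒x∈p-y v∈S v≢u)))
    proper′ : ProperOn (S - u) x
    proper′ v₁ v₂ v₁∈ v₂∈ v₁~v₂ eq =
      proper v₁ v₂ (proj₁ (x∈p-y⁻ v₁∈)) (proj₁ (x∈p-y⁻ v₂∈)) v₁~v₂ (begin
        toColouring (x [ u ]≔ b) v₁ ≡⟨ toColouring∘update′ x b (proj₂ (x∈p-y⁻ v₁∈)) ⟩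
        toColouring x v₁            ≡⟨ eq ⟩
        toColouring x v₂            ≡⟨ toColouring∘update′ x b (proj₂ (x∈p-y⁻ v₂∈)) ⟨
        toColouring (x [ u ]≔ b) v₂ ∎)
      where open ≡-Reasoning

  Conflict : Subset n → Fin n → Fin m → Colouring → Fin n → Set
  Conflict S w a x u = adj G w u ≡ true × u ∈ₛ S - w × toColouring x u ≡ colour w a

  conflict? : ∀ S w a x u → Dec (Conflict S w a x u)
  conflict? S w a x u =
    (adj G w u ≟ᵇ true) ×-dec (u ∈ₛ? S - w) ×-dec (toColouring x u ℕ.≟ colour w a)

  extend : ∀ {S w x} a → w ∈ₛ S → IsColouringOf (S - w) x → (∀ u → ¬ Conflict S w a x u) →
           IsColouringOf S (x [ w ]≔ a)
  extend {S} {w} {x} a w∈S (zero-off , proper) no-conflict = zero-off′ , proper′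
    where
    coloured-w : toColouring (x [ w ]≔ a) w ≡ colour w a
    coloured-w = cong (colour w) (lookup∘update w x a)
    unchanged : ∀ {v} → v ≢ w → toColouring (x [ w ]≔ a) v ≡ toColouring x v
    unchanged = toColouring∘update′ x a
    zero-off′ : ZeroOff S (x [ w ]≔ a)
    zero-off′ v v∉S = trans (lookup∘update′ v≢w x a) (zero-off v (v∉S ∘ proj₁ ∘ x∈p-y⁻))
      where v≢w : v ≢ w
            v≢w refl = v∉S w∈S
    proper′ : ProperOn S (x [ w ]≔ a)
    proper′ v₁ v₂ v₁∈ v₂∈ v₁~v₂ with v₁ ≟ w | v₂ ≟ w
    ... | yes refl | yes refl = contradiction v₁~v₂ (adj-irrefl G w)
    ... | yes refl | no v₂≢w  = λ eq → no-conflict v₂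
      (v₁~v₂ , x∈p∧x≢y⇒x∈p-y v₂∈ v₂≢w , trans (sym (unchanged v₂≢w)) (trans (sym eq) coloured-w))
    ... | no v₁≢w  | yes refl = λ eq → no-conflict v₁
      (trans (adj-sym G w v₁) v₁~v₂ , x∈p∧x≢y⇒x∈p-y v₁∈ v₁≢w , trans (sym (unchanged v₁≢w)) (trans eq coloured-w))
    ... | no v₁≢w  | no v₂≢w  = λ eq →
      proper v₁ v₂ (x∈p∧x≢y⇒x∈p-y v₁∈ v₁≢w) (x∈p∧x≢y⇒x∈p-y v₂∈ v₂≢w) v₁~v₂
        (trans (sym (unchanged v₁≢w)) (trans eq (unchanged v₂≢w)))

  conflicts : Subset n → Fin n → Fin m → Colouring → ℕ
  conflicts S w a x = ∑[ u < n ] (𝟙 (conflict? S w a x u) * χ (S - w) x)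

  conflictsAt : Subset n → Fin n → Fin m → Fin n → ℕ
  conflictsAt S w a u = ∑ᵛ n (λ x → 𝟙 (conflict? S w a x u) * χ (S - w) x)

  extension-bound : ∀ {S w} a x → w ∈ₛ S →
    χ (S - w) x ≤ 𝟙 (lookup x w ≟ zero′) * χ S (x [ w ]≔ a) + conflicts S w a x
  extension-bound {S} {w} a x w∈S = 𝟙-≤ (isColouringOf? (S - w) x) λ col → bound col (any? (conflict? S w a x))
    where
    bound : IsColouringOf (S - w) x → Dec (∃[ u ] Conflict S w a x u) →
            1 ≤ 𝟙 (lookup x w ≟ zero′) * χ S (x [ w ]≔ a) + conflicts S w a x
    bound col (yes (u , c)) = begin
      1                                                 ≡⟨ cong₂ _*_ (𝟙-yes (conflict? S w a x u) c)
                                                                     (𝟙-yes (isColouringOf? (S - w) x) col) ⟨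
      𝟙 (conflict? S w a x u) * χ (S - w) x            ≤⟨ ≤-sum (λ v → 𝟙 (conflict? S w a x v) * χ (S - w) x) u ⟩
      conflicts S w a x                                 ≤⟨ m≤n+m _ _ ⟩
      _                                                 ∎
      where open ≤-Reasoning
    bound col (no none) = begin
      1                                                 ≡⟨ cong₂ _*_ (𝟙-yes (lookup x w ≟ zero′) (proj₁ col w (x∉p-x w)))
                                                                     (𝟙-yes (isColouringOf? S (x [ w ]≔ a)) extended) ⟨
      𝟙 (lookup x w ≟ zero′) * χ S (x [ w ]≔ a)        ≤⟨ m≤m+n _ _ ⟩
      _                                                 ∎
      where open ≤-Reasoning
            extended = extend {x = x} a w∈S col (λ u c → none (u , c))

  colourings-fixing : ∀ {T u} b → u ∈ₛ T → ∑ᵛ n (λ x → 𝟙 (lookup x u ≟ b) * χ T x) ≤ count (T - u)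
  colourings-fixing {T} {u} b u∈T = begin
    ∑ᵛ n (λ x → 𝟙 (lookup x u ≟ b) * χ T x)               ≡⟨ ∑ᵛ-update n u b zero′ (χ T) ⟩
    ∑ᵛ n (λ x → 𝟙 (lookup x u ≟ zero′) * χ T (x [ u ]≔ b)) ≤⟨ ∑ᵛ-mono-≤ n (λ x →
      𝟙-mono₂ (lookup x u ≟ zero′) (isColouringOf? T (x [ u ]≔ b)) (isColouringOf? (T - u) x)
              (restrict {x = x} b u∈T)) ⟩
    count (T - u)                                          ∎
    where open ≤-Reasoning

  conflictsAt-free : ∀ {S w a u} → (∀ x → ¬ Conflict S w a x u) → conflictsAt S w a u ≡ 0
  conflictsAt-free {S} {w} {a} {u} none =
    trans (∑ᵛ-cong n λ x → cong (_* χ (S - w) x) (𝟙-no (conflict? S w a x u) (none x))) (∑ᵛ-zero n)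

  shares? : ∀ w c u → Dec (adj G w u ≡ true × c ∈ L u)
  shares? w c u = (adj G w u ≟ᵇ true) ×-dec (c ∈? L u)

  module _ {k} (sharing : ∀ v c → c ∈ L v → nbrsWithColour G L v c ≤ k) where

    sharing-bound : ∀ {w c} → c ∈ L w → ∀ A → ∑[ u < n ] (𝟙 (shares? w c u) * A) ≤ k * A
    sharing-bound {w} {c} c∈ A = begin
      ∑[ u < n ] (𝟙 (shares? w c u) * A)  ≡⟨ *-distribʳ-sum A (λ u → 𝟙 (shares? w c u)) ⟨
      (∑[ u < n ] 𝟙 (shares? w c u)) * A  ≡⟨ cong (_* A) (length-filter-tabulate (shares? w c) (λ u → u)) ⟨
      nbrsWithColour G L w c * A          ≤⟨ *-monoˡ-≤ A (sharing w c c∈) ⟩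
      k * A                               ∎
      where open ≤-Reasoning

    module _ (r : ℕ) .{{_ : NonZero r}} (r²+mk≤mr : r * r + m * k ≤ m * r) where

      RemovalBound : Subset n → Set
      RemovalBound S = ∀ {w} → w ∈ₛ S → r * count (S - w) ≤ count S

      conflictsAt-bound : ∀ {S w} a u → RemovalBound (S - w) →
                          r * conflictsAt S w a u ≤ 𝟙 (shares? w (colour w a) u) * count (S - w)
      conflictsAt-bound {S} {w} a u ih = bound (shares? w (colour w a) u) (u ∈ₛ? S - w)
        where
        none : (∀ x → ¬ Conflict S w a x u) → ∀ {R} → r * conflictsAt S w a u ≤ R
        none no-conflict = ≤-trans (≤-reflexive (trans (cong (r *_) (conflictsAt-free no-conflict)) (*-zeroʳ r))) z≤n
        bound : (sh : Dec (adj G w u ≡ true × colour w a ∈ L u)) → Dec (u ∈ₛ S - w) →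
                r * conflictsAt S w a u ≤ 𝟙 sh * count (S - w)
        bound (no ¬shared)     _        = none λ x c →
          ¬shared (proj₁ c , subst (_∈ L u) (proj₂ (proj₂ c)) (colour-∈ u _))
        bound (yes _)          (no u∉)  = none λ x c → u∉ (proj₁ (proj₂ c))
        bound (yes (_ , c∈Lu)) (yes u∈) = begin
          r * conflictsAt S w a u                            ≤⟨ *-monoʳ-≤ r (∑ᵛ-mono-≤ n λ x →
            *-monoˡ-≤ (χ (S - w) x) (𝟙-mono (conflict? S w a x u) (lookup x u ≟ b) (coloured-b x))) ⟩
          r * ∑ᵛ n (λ x → 𝟙 (lookup x u ≟ b) * χ (S - w) x)  ≤⟨ *-monoʳ-≤ r (colourings-fixing b u∈) ⟩
          r * count (S - w - u)                              ≤⟨ ih u∈ ⟩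
          count (S - w)                                      ≡⟨ *-identityˡ (count (S - w)) ⟨
          1 * count (S - w)                                  ∎
          where
          open ≤-Reasoning
          b = proj₁ (colour-surjective u c∈Lu)
          coloured-b : ∀ x → Conflict S w a x u → lookup x u ≡ b
          coloured-b x c = colour-injective u (trans (proj₂ (proj₂ c)) (sym (proj₂ (colour-surjective u c∈Lu))))

      count-step-from : ∀ {S w} → w ∈ₛ S → RemovalBound (S - w) → r * count (S - w) ≤ count S
      count-step-from {S} {w} w∈S ih = r*A≤P {m = m} {k} r²+mk≤mr extensions conflicts-total
        where
        A = count (S - w)
        extended : Fin m → Colouring → ℕ
        extended a x = 𝟙 (lookup x w ≟ zero′) * χ S (x [ w ]≔ a)
        Σconflicts : Fin m → ℕ
        Σconflicts a = ∑ᵛ n (conflicts S w a)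
        extensions : m * A ≤ count S + ∑[ a < m ] Σconflicts a
        extensions = begin
          m * A                                                  ≡⟨ sum-const m A ⟨
          ∑[ a < m ] A                                           ≤⟨ sum-mono-≤ (λ a →
            ≤-trans (∑ᵛ-mono-≤ n (λ x → extension-bound a x w∈S)) (≤-reflexive (∑ᵛ-distrib-+ n _ _))) ⟩
          ∑[ a < m ] (∑ᵛ n (extended a) + Σconflicts a)          ≡⟨ ∑-distrib-+ (∑ᵛ n ∘ extended) Σconflicts ⟩
          ∑[ a < m ] ∑ᵛ n (extended a) + ∑[ a < m ] Σconflicts a ≡⟨ cong (_+ ∑[ a < m ] Σconflicts a) (∑ᵛ-fibrewise n w zero′ (χ S)) ⟩
          count S + ∑[ a < m ] Σconflicts a                      ∎
          where open ≤-Reasoning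
        conflicts-with : ∀ a → r * Σconflicts a ≤ k * A
        conflicts-with a = begin
          r * Σconflicts a                                ≡⟨ cong (r *_) (∑ᵛ-∑-comm n (λ u x → 𝟙 (conflict? S w a x u) * χ (S - w) x)) ⟩
          r * ∑[ u < n ] conflictsAt S w a u              ≡⟨ *-distribˡ-sum r (conflictsAt S w a) ⟩
          ∑[ u < n ] (r * conflictsAt S w a u)            ≤⟨ sum-mono-≤ (λ u → conflictsAt-bound a u ih) ⟩
          ∑[ u < n ] (𝟙 (shares? w (colour w a) u) * A)   ≤⟨ sharing-bound (colour-∈ w a) A ⟩
          k * A                                           ∎
          where open ≤-Reasoning
        conflicts-total : r * ∑[ a < m ] Σconflicts a ≤ m * (k * A)
        conflicts-total = begin
          r * ∑[ a < m ] Σconflicts a   ≡⟨ *-distribˡ-sum r Σconflicts ⟩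
          ∑[ a < m ] (r * Σconflicts a) ≤⟨ sum-mono-≤ conflicts-with ⟩
          ∑[ a < m ] (k * A)            ≡⟨ sum-const m (k * A) ⟩
          m * (k * A)                   ∎
          where open ≤-Reasoning

      count-step : ∀ S → RemovalBound S
      count-step = WF.All.wfRec size-wellFounded _ RemovalBound λ S rec w∈S →
        count-step-from w∈S (rec (x∈p⇒∣p-x∣<∣p∣ w∈S))

      count-lower : ∀ S → r ^ ∣ S ∣ ≤ count S
      count-lower = WF.All.wfRec size-wellFounded _ (λ S → r ^ ∣ S ∣ ≤ count S) λ S rec →
        lower S rec (nonempty? S)
        where
        lower : ∀ S → (∀ {T} → ∣ T ∣ < ∣ S ∣ → r ^ ∣ T ∣ ≤ count T) → Dec (Nonempty S) → r ^ ∣ S ∣ ≤ count S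
        lower S rec (yes (w , w∈S)) = begin
          r ^ ∣ S ∣         ≡⟨ cong (r ^_) (x∈p⇒suc∣p-x∣≡∣p∣ w∈S) ⟨
          r * r ^ ∣ S - w ∣ ≤⟨ *-monoʳ-≤ r (rec (x∈p⇒∣p-x∣<∣p∣ w∈S)) ⟩
          r * count (S - w) ≤⟨ count-step S w∈S ⟩
          count S           ∎
          where open ≤-Reasoning
        lower S rec (no empty) = begin
          r ^ ∣ S ∣  ≡⟨ cong (r ^_) (trans (cong ∣_∣ (Empty-unique empty)) (∣⊥∣≡0 n)) ⟩
          1          ≡⟨ 𝟙-yes (isColouringOf? S blank) (blank-zero , λ u _ u∈S → contradiction (u , u∈S) empty) ⟨
          χ S blank  ≤⟨ ≤-∑ᵛ n (χ S) blank ⟩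
          count S    ∎
          where
          open ≤-Reasoning
          blank : Colouring
          blank = replicate n zero′
          blank-zero : ZeroOff S blank
          blank-zero v _ = lookup-replicate v zero′

      atLeastProperLColourings : AtLeastProperLColourings G L (r ^ n)
      atLeastProperLColourings =
        map toColouring colourings ,
        All.map⁺ (All.map (λ {x} → toColouring-proper {x}) (All.all-filter (isColouringOf? ⊤) (allVecs n))) ,
        AllPairs.map⁺ (AllPairs.map (λ {x} {y} x≢y same → x≢y (toColouring-injective {x} {y} same))
                                    (filter⁺ (isColouringOf? ⊤) (allVecs-unique n))) ,
        (begin
          r ^ n                               ≡⟨ cong (r ^_) (∣⊤∣≡n n) ⟨
          r ^ ∣ ⊤ {n} ∣                       ≤⟨ count-lower ⊤ ⟩
          count ⊤                             ≡⟨ length-filter-allVecs n (isColouringOf? ⊤) ⟨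
          length colourings                   ≡⟨ length-map toColouring colourings ⟨
          length (map toColouring colourings) ∎)
        where
        open ≤-Reasoning
        colourings = filter (isColouringOf? ⊤) (allVecs n)

corollary14 : (k : ℕ) → k ≥ 1 → (n : ℕ) → (G : Graph n) → (L : ListAssignment n)
    → IsSizeListAssignment (4 * k) L
    → (∀ (v : Fin n) (c : ℕ) → c ∈ L v → nbrsWithColour G L v c ≤ k)
    → AtLeastProperLColourings G L ((2 * k) ^ n)
corollary14 zero      () _ _ _ _ _
corollary14 k@(suc _) _  n G L L-size sharing =
  ListColouring.atLeastProperLColourings G L L-size sharing (2 * k) (≤-reflexive (balance k))
  where
  balance : ∀ k → 2 * k * (2 * k) + 4 * k * k ≡ 4 * k * (2 * k)
  balance = solve-∀
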